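{- Let $n\geq 3$ and $\vec{x}\in\mathbb{Z}^n$. If $k(\vec{x})<n$ and $\vec{x}(2)\leq\vec{x}(k(\vec{x})+1)$, then $f(\vec{x})=\vec{x}(k(\vec{x})+1)$.
   Context: For $\vec{x}\in\mathbb{Z}^n$ write $\vec{x}(i)$ for its $i$-th entry. $k(\vec{x})=n$ if $\vec{x}(1)>\cdots>\vec{x}(n)$, otherwise the least $k$ with $\vec{x}(k)\leq\vec{x}(k+1)$. $l(\vec{x})$ is the least $l$ with $1\leq l<k(\vec{x})$, $\vec{x}(l)>\vec{x}(l+1)+1$ and $\vec{x}(l+1)=\vec{x}(l+2)+1$ if it exists, otherwise $k(\vec{x})-1$. The function $f:\mathbb{Z}^n\to\mathbb{Z}$ (Bailey–Cowles) is given by: $f(\vec{x})=\vec{x}(1)$ if $k(\vec{x})=n$, and $f(\vec{x})=\max\{\vec{x}(l(\vec{x})+2),\vec{x}(k(\vec{x})+1)\}$ if $k(\vec{x})<n$. -}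

module Defs where

open import Data.Nat using (ℕ; zero; suc; _∸_; _<_; _<ᵇ_)
open import Data.Integer using (ℤ; 0ℤ; _≤?_; _+_; _>_; 1ℤ)
import Data.Integer as ℤ
open import Data.Fin using (Fin; fromℕ<)
open import Data.Bool using (Bool; true; false; if_then_else_; _∧_)
open import Data.Nat.Properties using (<ᵇ⇒<)
open import Relation.Nullary.Decidable using (⌊_⌋)
open import Data.Integer.Properties using () renaming (_≟_ to _≟ℤ_)
open import Relation.Binary.PropositionalEquality using (_≡_)

-- Vectors in ℤ^n are functions Fin n → ℤ (Fin n = {0,…,n-1}, so the paper's
-- entry x(i) is x at index i-1).

-- 1-based entry access, returning 0 for indices outside 1..n
-- (only ever used within range in the statement / definitions of k, l, f).
entry : ∀ {n} → (Fin n → ℤ) → ℕ → ℤ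
entry {n} x zero = 0ℤ
entry {n} x (suc i) with i <ᵇ n in eq
... | true  = x (fromℕ< (<ᵇ⇒< i n (subst-true eq)))
  where
    subst-true : ∀ {b} → b ≡ true → Data.Bool.T b
    subst-true Relation.Binary.PropositionalEquality.refl = _
... | false = 0ℤ

search : (ℕ → Bool) → ℕ → ℕ → ℕ → ℕ
search p i fuel d with fuel
... | zero = d
... | suc m = if p i then i else search p (suc i) m d

-- k(x): n if x(1) > ⋯ > x(n), else least k (1 ≤ k < n) with x(k) ≤ x(k+1)
kk : ∀ {n} → (Fin n → ℤ) → ℕ
kk {n} x = search (λ i → ⌊ entry x i ≤? entry x (suc i) ⌋) 1 (n ∸ 1) n

-- l(x): least l, 1 ≤ l < k(x), with x(l) > x(l+1)+1 and x(l+1) = x(l+2)+1,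
-- otherwise k(x) - 1
ll : ∀ {n} → (Fin n → ℤ) → ℕ
ll {n} x = search
  (λ l → ⌊ (entry x (suc l) + 1ℤ) ℤ.<? entry x l ⌋
       ∧ ⌊ entry x (suc l) ≟ℤ (entry x (suc (suc l)) + 1ℤ) ⌋)
  1 (kk x ∸ 1) (kk x ∸ 1)

f : ∀ {n} → (Fin n → ℤ) → ℤ
f {n} x = if kk x <ᵇ n
  then ℤ._⊔_ (entry x (suc (suc (ll x)))) (entry x (suc (kk x)))
  else entry x 1

-- Before position k(x) the entries strictly decrease, so every entry x(i) with 2 ≤ i ≤ k(x)
-- is at most x(2), hence at most x(k(x)+1). Since l(x) ≤ k(x) - 1, the index l(x)+2 is
-- either k(x)+1 itself or lies in that range, so the maximum defining f(x) is x(k(x)+1).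
module Submission where

open import Defs
open import Data.Nat using (ℕ; suc; zero; _≤_; _<_; _+_; _∸_; _≤′_; ≤′-reflexive; ≤′-step; s≤s; z≤n)
import Data.Nat.Properties as ℕ
open import Data.Fin using (Fin)
open import Data.Integer using (ℤ)
import Data.Integer as ℤ
import Data.Integer.Properties as ℤ
open import Data.Bool using (Bool; true; false; if_then_else_)
open import Data.Bool.Properties using (T-≡)
open import Data.Product using (_×_; _,_)
open import Data.Sum using (_⊎_; inj₁; inj₂)
open import Data.Empty using (⊥-elim)
open import Function.Bundles using (Equivalence)
open import Relation.Nullary.Decidable using (⌊_⌋; yes; no)
open import Relation.Binary.PropositionalEquality using (_≡_; refl; sym; cong; module ≡-Reasoning)

search-default-or-in-range : ∀ p i fuel d →
  search p i fuel d ≡ d ⊎ (i ≤ search p i fuel d × search p i fuel d < i + fuel)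
search-default-or-in-range p i zero    d = inj₁ refl
search-default-or-in-range p i (suc m) d with p i
... | true  = inj₂ (ℕ.≤-refl , ℕ.m<m+n i (s≤s z≤n))
... | false with search-default-or-in-range p (suc i) m d
...   | inj₁ found-default   = inj₁ found-default
...   | inj₂ (i<r , r<i+1+m) = inj₂ (ℕ.<⇒≤ i<r , ℕ.≤-trans r<i+1+m (ℕ.≤-reflexive (sym (ℕ.+-suc i m))))

search-minimal : ∀ p i fuel d j → i ≤ j → j < i + fuel → j < search p i fuel d → p j ≡ false
search-minimal p i zero d j i≤j j<i+0 _ =
  ⊥-elim (ℕ.<-irrefl refl (ℕ.<-≤-trans j<i+0 (ℕ.≤-trans (ℕ.≤-reflexive (ℕ.+-identityʳ i)) i≤j)))
search-minimal p i (suc m) d j i≤j j<i+1+m j<r with p i in pi≡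
... | true  = ⊥-elim (ℕ.<-irrefl refl (ℕ.<-≤-trans j<r i≤j))
... | false with i ℕ.≟ j
...   | yes refl = pi≡
...   | no  i≢j  = search-minimal p (suc i) m d j (ℕ.≤∧≢⇒< i≤j i≢j)
                     (ℕ.<-≤-trans j<i+1+m (ℕ.≤-reflexive (ℕ.+-suc i m))) j<r

module _ {n : ℕ} (x : Fin n → ℤ) where

  ascent? : ℕ → Bool
  ascent? i = ⌊ entry x i ℤ.≤? entry x (suc i) ⌋

  kk≤n : kk x ≤ n
  kk≤n with search-default-or-in-range ascent? 1 (n ∸ 1) n
  ... | inj₁ kk≡n            = ℕ.≤-reflexive kk≡n
  ... | inj₂ (_ , kk<1+n∸1) = ℕ.≤-trans (ℕ.m<1+n⇒m≤n kk<1+n∸1) (ℕ.m∸n≤m n 1)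

  kk-positive : kk x < n → 1 ≤ kk x
  kk-positive kk<n with search-default-or-in-range ascent? 1 (n ∸ 1) n
  ... | inj₁ kk≡n        = ⊥-elim (ℕ.<-irrefl kk≡n kk<n)
  ... | inj₂ (1≤kk , _) = 1≤kk

  kk-descending : ∀ {j} → 1 ≤ j → j < kk x → entry x (suc j) ℤ.< entry x j
  kk-descending {j} 1≤j j<kk
    with entry x j ℤ.≤? entry x (suc j)
       | search-minimal ascent? 1 (n ∸ 1) n j 1≤j
           (ℕ.<-≤-trans j<kk (ℕ.≤-trans kk≤n (ℕ.m≤n+m∸n n 1))) j<kk
  ... | no xj≰xj+1 | _ = ℤ.≰⇒> xj≰xj+1

  kk-antitone : ∀ {i j} → 1 ≤ i → i ≤′ j → j ≤ kk x → entry x j ℤ.≤ entry x i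
  kk-antitone _   (≤′-reflexive refl) _ = ℤ.≤-refl
  kk-antitone 1≤i (≤′-step i≤′j) 1+j≤kk =
    ℤ.≤-trans (ℤ.<⇒≤ (kk-descending (ℕ.≤-trans 1≤i (ℕ.≤′⇒≤ i≤′j)) 1+j≤kk))
              (kk-antitone 1≤i i≤′j (ℕ.<⇒≤ 1+j≤kk))

  ll≤kk∸1 : ll x ≤ kk x ∸ 1
  ll≤kk∸1 with search-default-or-in-range _ 1 (kk x ∸ 1) (kk x ∸ 1)
  ... | inj₁ ll≡kk∸1         = ℕ.≤-reflexive ll≡kk∸1
  ... | inj₂ (_ , ll<1+kk∸1) = ℕ.m<1+n⇒m≤n ll<1+kk∸1

  2+ll≤1+kk : kk x < n → 2 + ll x ≤ suc (kk x)
  2+ll≤1+kk kk<n = s≤s (ℕ.≤-trans (s≤s ll≤kk∸1) (ℕ.≤-reflexive (ℕ.m+[n∸m]≡n (kk-positive kk<n))))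

  f-of-kk<n : kk x < n → f x ≡ entry x (2 + ll x) ℤ.⊔ entry x (suc (kk x))
  f-of-kk<n kk<n =
    cong (λ b → if b then entry x (2 + ll x) ℤ.⊔ entry x (suc (kk x)) else entry x 1)
         (Equivalence.to T-≡ (ℕ.<⇒<ᵇ kk<n))

  entry-after-ll≤entry-after-kk : kk x < n → entry x 2 ℤ.≤ entry x (suc (kk x))
    → entry x (2 + ll x) ℤ.≤ entry x (suc (kk x))
  entry-after-ll≤entry-after-kk kk<n x₂≤ with ℕ.m≤n⇒m<n∨m≡n (2+ll≤1+kk kk<n)
  ... | inj₁ (s≤s 2+ll≤kk) = ℤ.≤-trans (kk-antitone (s≤s z≤n) (ℕ.≤⇒≤′ (s≤s (s≤s z≤n))) 2+ll≤kk) x₂≤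
  ... | inj₂ 2+ll≡1+kk     = ℤ.≤-reflexive (cong (entry x) 2+ll≡1+kk)

lemma3p4 : (n : ℕ) → 3 ≤ n → (x : Fin n → ℤ) → kk x < n
    → entry x 2 ℤ.≤ entry x (suc (kk x)) → f x ≡ entry x (suc (kk x))
lemma3p4 n _ x kk<n x₂≤ = begin
  f x                                               ≡⟨ f-of-kk<n x kk<n ⟩
  entry x (2 + ll x) ℤ.⊔ entry x (suc (kk x))       ≡⟨ ℤ.i≤j⇒i⊔j≡j (entry-after-ll≤entry-after-kk x kk<n x₂≤) ⟩
  entry x (suc (kk x))                              ∎
  where open ≡-Reasoning
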